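{- Let $d$ be a positive integer, $G$ a finite graph and $f_E$ an e-labeling of $G$ with values in $\mathbb{Z}_d$ such that $(G,f_E)$ is compatible. If a new edge $e$ is added to $G$ (with its endpoints being vertices of $G$ or new vertices), then $f_E$ can be extended by assigning a label in $\mathbb{Z}_d$ to $e$ so that the resulting e-labeled graph is compatible.
   Context: $\mathbb{Z}_d$ denotes the integers modulo $d$. A cycle of length $k$ is a closed walk, not necessarily simple, with edges $e_1,\dots,e_k$, $e_i=(v_i,v_{i+1})$ for $i<k$, $e_k=(v_k,v_1)$. Even cycle property: every cycle of even length with edges $e_1,\dots,e_{2k}$ satisfies $\sum_{l\text{ odd}}f_E(e_l)\equiv\sum_{l\text{ even}}f_E(e_l)\pmod d$. Odd cycle property ($d$ even): every cycle of odd length with edges $e_1,\dots,e_{2k+1}$ satisfies $\frac d2\sum_l f_E(e_l)\equiv0\pmod d$. An e-labeled graph is compatible if $d$ is odd and the even cycle property holds, or $d$ is even and both properties hold. -}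

module Defs where

open import Data.Nat using (ℕ; zero; suc; _+_; _/_)
import Data.Nat.Divisibility as ℕD
open import Data.Fin using (Fin; zero; suc; toℕ; _↑ˡ_; _↑ʳ_)
open import Data.Product using (_×_; _,_; map)
open import Data.Sum using (_⊎_)
open import Data.Integer as ℤ using (ℤ; +_; _-_)
import Data.Integer.Divisibility as ℤD
open import Relation.Nullary using (¬_)
open import Relation.Binary.PropositionalEquality using (_≡_)

-- A finite (multi)graph, loops and parallel edges allowed:
-- vertices Fin nV, edges Fin nE, each edge has an (unordered) pair of endpoints.
record Graph : Set where
  field
    nV    : ℕ
    nE    : ℕ
    ends  : Fin nE → Fin nV × Fin nV

open Graph public

Joins : (G : Graph) → Fin (nE G) → Fin (nV G) → Fin (nV G) → Set
Joins G e u v = ends G e ≡ (u , v) ⊎ ends G e ≡ (v , u)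

data Walk (G : Graph) : Fin (nV G) → Fin (nV G) → Set where
  []   : ∀ {v} → Walk G v v
  step : ∀ {u v w} (e : Fin (nE G)) → Joins G e u v → Walk G v w → Walk G u w

length : ∀ {G u v} → Walk G u v → ℕ
length []           = 0
length (step _ _ w) = suc (length w)

ELabeling : Graph → ℕ → Set
ELabeling G d = Fin (nE G) → Fin d

lab : ∀ {d} → Fin d → ℤ
lab x = + toℕ x

-- (sum over odd positions) - (sum over even positions), positions counted from 1
altSum : ∀ {G d u v} → ELabeling G d → Walk G u v → ℤ
altSum f []           = + 0
altSum f (step e _ w) = lab (f e) - altSum f w

totSum : ∀ {G d u v} → ELabeling G d → Walk G u v → ℤ
totSum f []           = + 0
totSum f (step e _ w) = lab (f e) ℤ.+ totSum f w

_≡[mod_]_ : ℤ → ℕ → ℤ → Set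
a ≡[mod d ] b = (+ d) ℤD.∣ (a - b)

-- a cycle = closed walk (cycles of length 0 are trivially fine for both properties)
EvenCycleProperty : (G : Graph) (d : ℕ) → ELabeling G d → Set
EvenCycleProperty G d f =
  ∀ (v : Fin (nV G)) (c : Walk G v v) → 2 ℕD.∣ length c →
  altSum f c ≡[mod d ] (+ 0)

OddCycleProperty : (G : Graph) (d : ℕ) → ELabeling G d → Set
OddCycleProperty G d f =
  ∀ (v : Fin (nV G)) (c : Walk G v v) → ¬ (2 ℕD.∣ length c) →
  ((+ (d / 2)) ℤ.* totSum f c) ≡[mod d ] (+ 0)

Compatible : (G : Graph) (d : ℕ) → ELabeling G d → Set
Compatible G d f =
  (¬ (2 ℕD.∣ d) × EvenCycleProperty G d f)
  ⊎ (2 ℕD.∣ d × EvenCycleProperty G d f × OddCycleProperty G d f)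

addEdge : (G : Graph) (a : ℕ) → Fin (nV G + a) → Fin (nV G + a) → Graph
addEdge G a u w = record
  { nV   = nV G + a
  ; nE   = suc (nE G)
  ; ends = λ { zero → (u , w) ; (suc e) → map (_↑ˡ a) (_↑ˡ a) (ends G e) } }

extend : ∀ {G d a u w} → ELabeling G d → Fin d → ELabeling (addEdge G a u w) d
extend f x zero    = x
extend f x (suc e) = f e

module Submission where

-- The proof goes through potentials: a potential of (G , f) is a map φ from vertices to ℤ
-- with f(e) ≡ φ(u) + φ(v) (mod d) for every edge e joining u and v.
--   (1) A potential forces compatibility: along a walk from u to v the alternating sum
--       telescopes to φ(u) ∓ φ(v), so an even closed walk has alternating sum 0 and an odd
--       one at v has alternating sum 2φ(v), which d/2 kills when d is even.
--   (2) Conversely every compatible labeling has a potential. Each vertex v gets a root r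
--       (the least vertex from which v is reachable) and a walk P from r to v; the root has
--       a centre c, i.e. 2c ≡ alternating sum of every odd closed walk at r (2 is invertible
--       when d is odd; the odd cycle property gives it when d is even). Then
--       φ(v) = ±(c - altSum P), and f(e) ≡ φ(a) + φ(b) for an edge e joining a and b is the
--       cycle condition for the closed walk r → a → b → r. Roots are chosen with a decision
--       procedure for reachability in the parity cover of G (Floyd–Warshall), which also
--       decides whether odd closed walks exist.
--   (3) Extending a potential of G by 0 on the new vertices gives a potential of the new
--       graph once the new edge is labelled φ(u) + φ(w) mod d; then (1) applies.

module CompatibleLabelings where

  open import Defs
  open import Data.Bool using (Bool; true; false; T; if_then_else_)
  open import Data.Empty using (⊥-elim)
  open import Data.Fin using (Fin; zero; suc; fromℕ<; splitAt; _↑ˡ_)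
  import Data.Fin.Properties as FinP
  open import Data.Integer using (ℤ; +_; _+_; _-_; -_; _*_)
  import Data.Integer.Properties as ℤP
  open import Data.Integer.DivMod using (_%ℕ_; _/ℕ_; n%ℕd<d; a≡a%ℕn+[a/ℕn]*n)
  import Data.Integer.Divisibility.Signed as ℤD
  open import Data.Integer.Tactic.RingSolver using (solve-∀)
  open import Data.List using (List; []; _∷_; allFin; cartesianProduct)
  open import Data.List.Membership.Propositional using (_∈_)
  open import Data.List.Membership.Propositional.Properties using (∈-allFin; ∈-cartesianProduct⁺)
  open import Data.List.Relation.Unary.Any using (here; there)
  open import Data.Maybe as Maybe using (Maybe; just; nothing)
  open import Data.Maybe.Properties using (just-injective)
  open import Data.Nat as ℕ using (ℕ; zero; suc; NonZero; parity; _/_)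
  import Data.Nat.Divisibility as ℕD
  open import Data.Nat.DivMod using (m*n/n≡m; m/n*n≡m)
  import Data.Nat.Properties as ℕP
  open import Data.Parity.Base using (Parity; 0ℙ; 1ℙ; _⁻¹) renaming (_+_ to _⊕_)
  import Data.Parity.Properties as ℙP
  open import Data.Product using (∃; _×_; _,_; proj₁; proj₂)
  import Data.Product.Properties as ×P
  open import Data.Sum using (_⊎_; inj₁; inj₂; [_,_]′)
  open import Data.Unit using (tt)
  open import Function using (_∘_; const)
  open import Function.Bundles using (mk⇔)
  open import Level using (0ℓ)
  open import Relation.Binary.Bundles using (Setoid)
  open import Relation.Binary.Core using (Rel)
  open import Relation.Binary.Definitions using (Decidable; DecidableEquality)
  open import Relation.Binary.Construct.Closure.ReflexiveTransitive using (Star; ε; _◅_; _◅◅_)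
  open import Relation.Binary.PropositionalEquality
  import Relation.Binary.Reasoning.Setoid as SetoidReasoning
  open import Relation.Nullary using (¬_; Dec; yes; no; does)
  open import Relation.Nullary.Decidable
    using (map′; _⊎-dec_; _×-dec_; isYes; isYes≗does; does-⇔; toWitness; fromWitness)

  parity-suc : ∀ n → parity (suc n) ≡ parity n ⁻¹
  parity-suc n = ℙP.+-homo-+ 1 n

  -- divisibility by 2 is even parity; the cycle properties speak of the former,
  -- the parity cover of a graph of the latter
  even⇒parity : ∀ {n} → 2 ℕD.∣ n → parity n ≡ 0ℙ
  even⇒parity (ℕD.divides q refl) = trans (ℙP.*-homo-* q 2) (ℙP.*-zeroʳ (parity q))

  parity⇒even : ∀ n → parity n ≡ 0ℙ → 2 ℕD.∣ n
  parity⇒even zero          _    = ℕD.divides 0 refl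
  parity⇒even (suc (suc n)) even = ℕD.∣m∣n⇒∣m+n ℕD.∣-refl (parity⇒even n even)

  odd⇒parity : ∀ {n} → ¬ 2 ℕD.∣ n → parity n ≡ 1ℙ
  odd⇒parity {n} odd with parity n in eq
  ... | 0ℙ = ⊥-elim (odd (parity⇒even n eq))
  ... | 1ℙ = refl

  parity⇒odd : ∀ {n} → parity n ≡ 1ℙ → ¬ 2 ℕD.∣ n
  parity⇒odd odd even with () ← trans (sym (even⇒parity even)) odd

  odd-form : ∀ n → parity n ≡ 1ℙ → ∃ λ m → n ≡ suc (m ℕ.* 2)
  odd-form (suc zero)    _   = 0 , refl
  odd-form (suc (suc n)) odd with odd-form n odd
  ... | m , refl = suc m , refl

  -- (-1)^p, the sign of the last term of an alternating sum of length of parity p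
  sign : Parity → ℤ
  sign 0ℙ = + 1
  sign 1ℙ = - + 1

  sign-suc : ∀ n → sign (parity (suc n)) ≡ - sign (parity n)
  sign-suc n rewrite parity-suc n with parity n
  ... | 0ℙ = refl
  ... | 1ℙ = refl

  -- Congruence modulo d, stated with signed divisibility so that it can be manipulated
  -- algebraically, and wrapped in a record so that its two sides can be inferred.

  infix 4 _≈_[mod_]
  record _≈_[mod_] (a b : ℤ) (d : ℕ) : Set where
    constructor congruent
    field difference : + d ℤD.∣ (a - b)
  open _≈_[mod_]

  ≈⇒≡[mod] : ∀ {a b d} → a ≈ b [mod d ] → a ≡[mod d ] b
  ≈⇒≡[mod] = ℤD.∣⇒∣ᵤ ∘ difference

  ≡[mod]⇒≈ : ∀ {a b d} → a ≡[mod d ] b → a ≈ b [mod d ]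
  ≡[mod]⇒≈ = congruent ∘ ℤD.∣ᵤ⇒∣

  module _ {d : ℕ} where

    ≈-by : ∀ {a b x y} k → a - b ≡ k * (x - y) → x ≈ y [mod d ] → a ≈ b [mod d ]
    ≈-by k eq (congruent x≈y) = congruent (subst (+ d ℤD.∣_) (sym eq) (ℤD.∣n⇒∣m*n k x≈y))

    ≈-reflexive : ∀ {a b} → a ≡ b → a ≈ b [mod d ]
    ≈-reflexive {a} refl = congruent (ℤD.divides (+ 0) (ℤP.+-inverseʳ a))

    ≈-sym : ∀ {a b} → a ≈ b [mod d ] → b ≈ a [mod d ]
    ≈-sym {a} {b} = ≈-by (- + 1) (negate b a)
      where negate : ∀ b a → b - a ≡ - + 1 * (a - b)
            negate = solve-∀

    ≈-trans : ∀ {a b c} → a ≈ b [mod d ] → b ≈ c [mod d ] → a ≈ c [mod d ]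
    ≈-trans {a} {b} {c} (congruent a≈b) (congruent b≈c) =
      congruent (subst (+ d ℤD.∣_) (chain a b c) (ℤD.∣m∣n⇒∣m+n a≈b b≈c))
      where chain : ∀ a b c → (a - b) + (b - c) ≡ a - c
            chain = solve-∀

    +-cong : ∀ {a b x y} → a ≈ b [mod d ] → x ≈ y [mod d ] → a + x ≈ b + y [mod d ]
    +-cong {a} {b} {x} {y} (congruent a≈b) (congruent x≈y) =
      congruent (subst (+ d ℤD.∣_) (regroup a b x y) (ℤD.∣m∣n⇒∣m+n a≈b x≈y))
      where regroup : ∀ a b x y → (a - b) + (x - y) ≡ (a + x) - (b + y)
            regroup = solve-∀

    −-cong : ∀ {a b x y} → a ≈ b [mod d ] → x ≈ y [mod d ] → a - x ≈ b - y [mod d ]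
    −-cong {a} {b} {x} {y} (congruent a≈b) (congruent x≈y) =
      congruent (subst (+ d ℤD.∣_) (regroup a b x y) (ℤD.∣m∣n⇒∣m-n a≈b x≈y))
      where regroup : ∀ a b x y → (a - b) - (x - y) ≡ (a - x) - (b - y)
            regroup = solve-∀

    *-congˡ : ∀ k {a b} → a ≈ b [mod d ] → k * a ≈ k * b [mod d ]
    *-congˡ k {a} {b} = ≈-by k (distrib k a b)
      where distrib : ∀ k a b → k * a - k * b ≡ k * (a - b)
            distrib = solve-∀

    multiple : ∀ k → k * + d ≈ + 0 [mod d ]
    multiple k = congruent (ℤD.divides k (ℤP.+-identityʳ (k * + d)))

  mod-setoid : ℕ → Setoid 0ℓ 0ℓ
  mod-setoid d = record
    { Carrier       = ℤ
    ; _≈_           = λ a b → a ≈ b [mod d ]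
    ; isEquivalence = record { refl = ≈-reflexive refl ; sym = ≈-sym ; trans = ≈-trans }
    }

  half-mod-odd : ∀ {d} → parity d ≡ 1ℙ → ∀ a → ∃ λ c → c + c ≈ a [mod d ]
  half-mod-odd {d} odd a with odd-form d odd
  ... | m , refl = c , congruent (subst (+ d ℤD.∣_) (sym doubled) (ℤD.divides a refl))
    where
    c = a * (+ 1 + + m)
    d≡1+2m : + d ≡ + 1 + + m * + 2
    d≡1+2m = trans (ℤP.pos-+ 1 (m ℕ.* 2)) (cong (λ t → + 1 + t) (ℤP.pos-* m 2))
    identity : ∀ a m → (a * (+ 1 + m) + a * (+ 1 + m)) - a ≡ a * (+ 1 + m * + 2)
    identity = solve-∀
    doubled : (c + c) - a ≡ a * + d
    doubled = trans (identity a (+ m)) (cong (a *_) (sym d≡1+2m))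

  half-double : ∀ {d} → 2 ℕD.∣ d → + (d / 2) * + 2 ≡ + d
  half-double {d} d-even = trans (sym (ℤP.pos-* (d / 2) 2)) (cong +_ (m/n*n≡m d-even))

  even-half : ∀ {d} .{{_ : NonZero d}} → 2 ℕD.∣ d →
              ∀ t → + (d / 2) * t ≈ + 0 [mod d ] → ∃ λ j → t ≡ j + j
  even-half {d} d-even@(ℕD.divides q refl) t (congruent kills) with ℤD.*-cancelˡ-∣ (+ q) {{q≢0}} q2∣qt
    where
    q≢0 : NonZero q
    q≢0 = ℕP.m*n≢0⇒m≢0 q
    q2∣qt : + q * + 2 ℤD.∣ + q * t
    q2∣qt = subst₂ ℤD._∣_
      (trans (sym (half-double d-even)) (cong (λ h → + h * + 2) (m*n/n≡m q 2)))
      (trans (ℤP.+-identityʳ _) (cong (λ h → + h * t) (m*n/n≡m q 2)))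
      kills
  ... | ℤD.divides j refl = j , double j
    where double : ∀ j → j * + 2 ≡ j + j
          double = solve-∀

  infixr 5 _++_
  _++_ : ∀ {G u v w} → Walk G u v → Walk G v w → Walk G u w
  []           ++ Q = Q
  step e j P   ++ Q = step e j (P ++ Q)

  joins-sym : ∀ {G e u v} → Joins G e u v → Joins G e v u
  joins-sym (inj₁ eq) = inj₂ eq
  joins-sym (inj₂ eq) = inj₁ eq

  reverse : ∀ {G u v} → Walk G u v → Walk G v u
  reverse []           = []
  reverse {G} (step e j P) = reverse P ++ step e (joins-sym {G} {e} j) []

  length-++ : ∀ {G u v w} (P : Walk G u v) (Q : Walk G v w) → length (P ++ Q) ≡ length P ℕ.+ length Q
  length-++ []           Q = refl
  length-++ (step e j P) Q = cong suc (length-++ P Q)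

  length-reverse : ∀ {G u v} (P : Walk G u v) → length (reverse P) ≡ length P
  length-reverse []           = refl
  length-reverse (step e j P) = begin
    length (reverse (step e j P))                   ≡⟨ length-++ (reverse P) _ ⟩
    length (reverse P) ℕ.+ 1                        ≡⟨ ℕP.+-comm (length (reverse P)) 1 ⟩
    suc (length (reverse P))                        ≡⟨ cong suc (length-reverse P) ⟩
    suc (length P)                                  ∎
    where open ≡-Reasoning

  parity-++ : ∀ {G u v w} (P : Walk G u v) (Q : Walk G v w) →
              parity (length (P ++ Q)) ≡ parity (length P) ⊕ parity (length Q)
  parity-++ P Q = trans (cong parity (length-++ P Q)) (ℙP.+-homo-+ (length P) (length Q))

  module _ {G : Graph} {d : ℕ} (f : ELabeling G d) where

    altSum-++ : ∀ {u v w} (P : Walk G u v) (Q : Walk G v w) →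
                altSum f (P ++ Q) ≡ altSum f P + sign (parity (length P)) * altSum f Q
    altSum-++ []           Q = unit (altSum f Q)
      where unit : ∀ a → a ≡ + 0 + + 1 * a
            unit = solve-∀
    altSum-++ (step e j P) Q = begin
      lab (f e) - altSum f (P ++ Q)                          ≡⟨ cong (λ t → lab (f e) - t) (altSum-++ P Q) ⟩
      lab (f e) - (altSum f P + s * altSum f Q)              ≡⟨ regroup (lab (f e)) (altSum f P) s (altSum f Q) ⟩
      (lab (f e) - altSum f P) + (- s) * altSum f Q          ≡⟨ cong (λ t → (lab (f e) - altSum f P) + t * altSum f Q) (sym (sign-suc (length P))) ⟩
      (lab (f e) - altSum f P) + sign (parity (suc (length P))) * altSum f Q ∎
      where
      open ≡-Reasoning
      s = sign (parity (length P))
      regroup : ∀ l a s b → l - (a + s * b) ≡ (l - a) + (- s) * b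
      regroup = solve-∀

    altSum-reverse : ∀ {u v} (P : Walk G u v) →
                     altSum f (reverse P) ≡ - (sign (parity (length P)) * altSum f P)
    altSum-reverse []           = refl
    altSum-reverse (step e j P) = begin
      altSum f (reverse P ++ step e _ [])                              ≡⟨ altSum-++ (reverse P) _ ⟩
      altSum f (reverse P) + sign (parity (length (reverse P))) * (l - + 0)
                                       ≡⟨ cong₂ (λ a n → a + sign (parity n) * (l - + 0)) (altSum-reverse P) (length-reverse P) ⟩
      - (s * altSum f P) + s * (l - + 0)                               ≡⟨ regroup l (altSum f P) s ⟩
      - ((- s) * (l - altSum f P))                                     ≡⟨ cong (λ t → - (t * (l - altSum f P))) (sym (sign-suc (length P))) ⟩
      - (sign (parity (suc (length P))) * (l - altSum f P))            ∎
      where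
      open ≡-Reasoning
      l = lab (f e)
      s = sign (parity (length P))
      regroup : ∀ l a s → - (s * a) + s * (l - + 0) ≡ - ((- s) * (l - a))
      regroup = solve-∀

    totSum-altSum : ∀ {u v} (P : Walk G u v) → ∃ λ k → totSum f P ≡ altSum f P + (k + k)
    totSum-altSum []           = + 0 , refl
    totSum-altSum (step e j P) with totSum-altSum P
    ... | k , eq = k + altSum f P , trans (cong (λ t → lab (f e) + t) eq) (regroup (lab (f e)) (altSum f P) k)
      where regroup : ∀ l a k → l + (a + (k + k)) ≡ (l - a) + ((k + a) + (k + a))
            regroup = solve-∀

  -- (1) Potentials and the compatibility they force.

  record IsPotential (G : Graph) (d : ℕ) (f : ELabeling G d) (φ : Fin (nV G) → ℤ) : Set where
    constructor edge-sums
    field edge-sum : ∀ e → lab (f e) ≈ φ (proj₁ (ends G e)) + φ (proj₂ (ends G e)) [mod d ]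

  module FromPotential {G : Graph} {d : ℕ} {f : ELabeling G d} {φ : Fin (nV G) → ℤ}
                       (potential : IsPotential G d f φ) where
    open SetoidReasoning (mod-setoid d)

    joins-potential : ∀ {e u v} → Joins G e u v → lab (f e) ≈ φ u + φ v [mod d ]
    joins-potential {e} (inj₁ eq) = subst (λ uv → lab (f e) ≈ φ (proj₁ uv) + φ (proj₂ uv) [mod d ]) eq (IsPotential.edge-sum potential e)
    joins-potential {e} {u} {v} (inj₂ eq) =
      ≈-trans (joins-potential {e} {v} {u} (inj₁ eq)) (≈-reflexive (ℤP.+-comm (φ v) (φ u)))

    -- the alternating sum along a walk telescopes
    telescope : ∀ {u v} (P : Walk G u v) → altSum f P ≈ φ u - sign (parity (length P)) * φ v [mod d ]
    telescope {u} []           = ≈-reflexive (sym (cancel (φ u)))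
      where cancel : ∀ x → x - + 1 * x ≡ + 0
            cancel = solve-∀
    telescope {u} {v} (step {v = m} e j P) = begin
      lab (f e) - altSum f P                  ≈⟨ −-cong (joins-potential j) (telescope P) ⟩
      (φ u + φ m) - (φ m - s * φ v)           ≡⟨ regroup (φ u) (φ m) s (φ v) ⟩
      φ u - (- s) * φ v                       ≡⟨ cong (λ t → φ u - t * φ v) (sym (sign-suc (length P))) ⟩
      φ u - sign (parity (suc (length P))) * φ v ∎
      where
      s = sign (parity (length P))
      regroup : ∀ x y s z → (x + y) - (y - s * z) ≡ x - (- s) * z
      regroup = solve-∀

    -- an even closed walk at v has alternating sum φ(v) - φ(v) = 0
    even-cycles : EvenCycleProperty G d f
    even-cycles v c c-even = ≈⇒≡[mod] (begin
      altSum f c                              ≈⟨ telescope c ⟩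
      φ v - sign (parity (length c)) * φ v    ≡⟨ cong (λ p → φ v - sign p * φ v) (even⇒parity c-even) ⟩
      φ v - + 1 * φ v                         ≡⟨ cancel (φ v) ⟩
      + 0                                     ∎)
      where cancel : ∀ x → x - + 1 * x ≡ + 0
            cancel = solve-∀

    -- an odd closed walk at v has alternating sum 2φ(v), and its total sum has the same
    -- parity, so d/2 times it is a multiple of d
    odd-cycles : 2 ℕD.∣ d → OddCycleProperty G d f
    odd-cycles d-even v c c-odd with totSum-altSum f c
    ... | k , tot≡ = ≈⇒≡[mod] (begin
      h * totSum f c                                      ≡⟨ cong (h *_) tot≡ ⟩
      h * (altSum f c + (k + k))                          ≈⟨ *-congˡ h (+-cong (telescope c) (≈-reflexive refl)) ⟩
      h * ((φ v - sign (parity (length c)) * φ v) + (k + k))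
                                 ≡⟨ cong (λ p → h * ((φ v - sign p * φ v) + (k + k))) (odd⇒parity c-odd) ⟩
      h * ((φ v - (- + 1) * φ v) + (k + k))               ≡⟨ regroup h (φ v) k ⟩
      (φ v + k) * (h * + 2)                               ≡⟨ cong ((φ v + k) *_) (half-double d-even) ⟩
      (φ v + k) * + d                                     ≈⟨ multiple (φ v + k) ⟩
      + 0                                                 ∎)
      where
      h = + (d / 2)
      regroup : ∀ h x k → h * ((x - (- + 1) * x) + (k + k)) ≡ (x + k) * (h * + 2)
      regroup = solve-∀

    compatible : Compatible G d f
    compatible with 2 ℕD.∣? d
    ... | no  d-odd  = inj₁ (d-odd , even-cycles)
    ... | yes d-even = inj₂ (d-even , even-cycles , odd-cycles d-even)

  compatible⇒even : ∀ {G d} {f : ELabeling G d} → Compatible G d f → EvenCycleProperty G d f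
  compatible⇒even (inj₁ (_ , even)) = even
  compatible⇒even (inj₂ (_ , even , _)) = even

  Halvable : (G : Graph) (d : ℕ) → ELabeling G d → Set
  Halvable G d f = ∀ {r} (O : Walk G r r) → parity (length O) ≡ 1ℙ → ∃ λ c → c + c ≈ altSum f O [mod d ]

  -- compatibility makes alternating sums of odd closed walks halvable: for odd d every
  -- integer is, for even d the odd cycle property makes the total sum (hence the
  -- alternating sum) even
  compatible⇒halvable : ∀ {G d} .{{_ : NonZero d}} (f : ELabeling G d) → Compatible G d f → Halvable G d f
  compatible⇒halvable f (inj₁ (d-odd , _)) O _ = half-mod-odd (odd⇒parity d-odd) (altSum f O)
  compatible⇒halvable f (inj₂ (d-even , _ , odd-cycles)) {r} O O-odd
    with totSum-altSum f O | even-half d-even (totSum f O) (≡[mod]⇒≈ (odd-cycles r O (parity⇒odd O-odd)))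
  ... | k , tot≡ | j , tot≡2j = j - k , ≈-reflexive (begin
      (j - k) + (j - k)                       ≡⟨ regroup j k ⟩
      (j + j) - (k + k)                       ≡⟨ cong (λ t → t - (k + k)) (trans (sym tot≡2j) tot≡) ⟩
      (altSum f O + (k + k)) - (k + k)        ≡⟨ cancel (altSum f O) (k + k) ⟩
      altSum f O                              ∎)
    where
    open ≡-Reasoning
    regroup : ∀ j k → (j - k) + (j - k) ≡ (j + j) - (k + k)
    regroup = solve-∀
    cancel : ∀ a b → (a + b) - b ≡ a
    cancel = solve-∀

  Balanced : ℕ → ℤ → Parity → ℤ → Set
  Balanced d c 0ℙ a = a ≈ + 0 [mod d ]
  Balanced d c 1ℙ a = c + c ≈ a [mod d ]

  -- the edge identity behind the potential: for walks P, P' from a centre to the two ends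
  -- of an edge with label l, the balance of the closed walk P · edge · P'⁻¹ gives
  -- l ≡ ±(c - altSum P) ± (c - altSum P')
  balanced-edge : ∀ {d} p p' l c a a' → Balanced d c (p ⊕ p' ⁻¹) (a + sign p * (l + sign p' * a')) →
                  l ≈ sign p * (c - a) + sign p' * (c - a') [mod d ]
  balanced-edge 0ℙ 0ℙ l c a a' = ≈-by (- + 1) (identity l c a a')
    where identity : ∀ l c a a' → l - (+ 1 * (c - a) + + 1 * (c - a')) ≡ - + 1 * ((c + c) - (a + + 1 * (l + + 1 * a')))
          identity = solve-∀
  balanced-edge 1ℙ 1ℙ l c a a' = ≈-by (+ 1) (identity l c a a')
    where identity : ∀ l c a a' → l - (- + 1 * (c - a) + - + 1 * (c - a')) ≡ + 1 * ((c + c) - (a + - + 1 * (l + - + 1 * a')))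
          identity = solve-∀
  balanced-edge 0ℙ 1ℙ l c a a' = ≈-by (+ 1) (identity l c a a')
    where identity : ∀ l c a a' → l - (+ 1 * (c - a) + - + 1 * (c - a')) ≡ + 1 * ((a + + 1 * (l + - + 1 * a')) - + 0)
          identity = solve-∀
  balanced-edge 1ℙ 0ℙ l c a a' = ≈-by (- + 1) (identity l c a a')
    where identity : ∀ l c a a' → l - (- + 1 * (c - a) + + 1 * (c - a')) ≡ - + 1 * ((a + - + 1 * (l + + 1 * a')) - + 0)
          identity = solve-∀

  -- Decidable reachability for a decidable relation on a finite set (Floyd–Warshall).

  module FiniteReachability {S : Set} (_≟_ : DecidableEquality S) {_⟶_ : Rel S 0ℓ} (_⟶?_ : Decidable _⟶_)
                            (elements : List S) (complete : ∀ x → x ∈ elements) where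

    -- Via vs x y: a path from x to y all of whose intermediate points lie in vs
    private
      Via : List S → S → S → Set
      Via []       x y = x ≡ y ⊎ x ⟶ y
      Via (v ∷ vs) x y = Via vs x y ⊎ (Via vs x v × Via vs v y)

      via? : ∀ vs x y → Dec (Via vs x y)
      via? []       x y = (x ≟ y) ⊎-dec (x ⟶? y)
      via? (v ∷ vs) x y = via? vs x y ⊎-dec (via? vs x v ×-dec via? vs v y)

      via⇒star : ∀ vs {x y} → Via vs x y → Star _⟶_ x y
      via⇒star []       (inj₁ refl)    = ε
      via⇒star []       (inj₂ s)       = s ◅ ε
      via⇒star (v ∷ vs) (inj₁ p)       = via⇒star vs p
      via⇒star (v ∷ vs) (inj₂ (p , q)) = via⇒star vs p ◅◅ via⇒star vs q

      via-refl : ∀ vs {x} → Via vs x x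
      via-refl []       = inj₁ refl
      via-refl (v ∷ vs) = inj₁ (via-refl vs)

      via-step : ∀ vs {x y} → x ⟶ y → Via vs x y
      via-step []       s = inj₂ s
      via-step (v ∷ vs) s = inj₁ (via-step vs s)

      via-trans : ∀ vs {x m y} → m ∈ vs → Via vs x m → Via vs m y → Via vs x y
      via-trans (v ∷ vs) (here refl) p q = inj₂ (to-v p , from-v q)
        where
        to-v : ∀ {x} → Via (v ∷ vs) x v → Via vs x v
        to-v (inj₁ p)       = p
        to-v (inj₂ (p , _)) = p
        from-v : ∀ {y} → Via (v ∷ vs) v y → Via vs v y
        from-v (inj₁ q)       = q
        from-v (inj₂ (_ , q)) = q
      via-trans (v ∷ vs) (there m∈) (inj₁ p)        (inj₁ q)        = inj₁ (via-trans vs m∈ p q)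
      via-trans (v ∷ vs) (there m∈) (inj₁ p)        (inj₂ (q₁ , q₂)) = inj₂ (via-trans vs m∈ p q₁ , q₂)
      via-trans (v ∷ vs) (there m∈) (inj₂ (p₁ , p₂)) (inj₁ q)        = inj₂ (p₁ , via-trans vs m∈ p₂ q)
      via-trans (v ∷ vs) (there m∈) (inj₂ (p₁ , _))  (inj₂ (_ , q₂))  = inj₂ (p₁ , q₂)

      star⇒via : ∀ {x y} → Star _⟶_ x y → Via elements x y
      star⇒via ε        = via-refl elements
      star⇒via (s ◅ ss) = via-trans elements (complete _) (via-step elements s) (star⇒via ss)

    star? : Decidable (Star _⟶_)
    star? x y = map′ (via⇒star elements) star⇒via (via? elements x y)

  module GraphReachability (G : Graph) where

    State : Set
    State = Fin (nV G) × Parity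

    _⟶_ : Rel State 0ℓ
    s ⟶ t = (∃ λ e → Joins G e (proj₁ s) (proj₁ t)) × proj₂ t ≡ proj₂ s ⁻¹

    private
      joins? : ∀ e a b → Dec (Joins G e a b)
      joins? e a b = ×P.≡-dec FinP._≟_ FinP._≟_ (ends G e) (a , b) ⊎-dec ×P.≡-dec FinP._≟_ FinP._≟_ (ends G e) (b , a)

      _⟶?_ : Decidable _⟶_
      s ⟶? t = FinP.any? (λ e → joins? e (proj₁ s) (proj₁ t)) ×-dec (proj₂ t ℙP.≟ proj₂ s ⁻¹)

      states : List State
      states = cartesianProduct (allFin (nV G)) (0ℙ ∷ 1ℙ ∷ [])

      states-complete : ∀ s → s ∈ states
      states-complete (a , 0ℙ) = ∈-cartesianProduct⁺ (∈-allFin a) (here refl)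
      states-complete (a , 1ℙ) = ∈-cartesianProduct⁺ (∈-allFin a) (there (here refl))

      open FiniteReachability (×P.≡-dec FinP._≟_ ℙP._≟_) _⟶?_ states states-complete

      flip-shift : ∀ p n → p ⁻¹ ⊕ parity n ≡ p ⊕ parity (suc n)
      flip-shift p n rewrite parity-suc n with p | parity n
      ... | 0ℙ | _  = refl
      ... | 1ℙ | 0ℙ = refl
      ... | 1ℙ | 1ℙ = refl

      star⇒walk : ∀ {a p b q} → Star _⟶_ (a , p) (b , q) → ∃ λ (w : Walk G a b) → q ≡ p ⊕ parity (length w)
      star⇒walk {p = p} ε = [] , sym (ℙP.+-identityʳ p)
      star⇒walk {p = p} (((e , j) , refl) ◅ ss) with star⇒walk ss
      ... | w , q≡ = step e j w , trans q≡ (flip-shift p (length w))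

      walk⇒star : ∀ {a b} p (w : Walk G a b) → Star _⟶_ (a , p) (b , p ⊕ parity (length w))
      walk⇒star {a} p []           = subst (λ q → Star _⟶_ (a , p) (a , q)) (sym (ℙP.+-identityʳ p)) ε
      walk⇒star {b = b} p (step {v = m} e j w) =
        ((e , j) , refl) ◅ subst (λ q → Star _⟶_ (m , p ⁻¹) (b , q)) (flip-shift p (length w)) (walk⇒star (p ⁻¹) w)

      walk⇒cover : ∀ {a b} → Walk G a b → Star _⟶_ (a , 0ℙ) (b , 0ℙ) ⊎ Star _⟶_ (a , 0ℙ) (b , 1ℙ)
      walk⇒cover w with parity (length w) | walk⇒star 0ℙ w
      ... | 0ℙ | s = inj₁ s
      ... | 1ℙ | s = inj₂ s

    walk? : ∀ a b → Dec (Walk G a b)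
    walk? a b = map′ [ proj₁ ∘ star⇒walk , proj₁ ∘ star⇒walk ]′ walk⇒cover
                     (star? (a , 0ℙ) (b , 0ℙ) ⊎-dec star? (a , 0ℙ) (b , 1ℙ))

    odd-loop? : ∀ r → Dec (∃ λ (O : Walk G r r) → parity (length O) ≡ 1ℙ)
    odd-loop? r = map′ (λ s → let (O , odd) = star⇒walk s in O , sym odd)
                       (λ (O , odd) → subst (λ q → Star _⟶_ (r , 0ℙ) (r , q)) odd (walk⇒star 0ℙ O))
                       (star? (r , 0ℙ) (r , 1ℙ))

  first : ∀ {n} → (Fin n → Bool) → Maybe (Fin n)
  first {zero}  t = nothing
  first {suc n} t = if t zero then just zero else Maybe.map suc (first (t ∘ suc))

  first-ext : ∀ {n} (t t' : Fin n → Bool) → (∀ i → t i ≡ t' i) → first t ≡ first t'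
  first-ext {zero}  t t' eq = refl
  first-ext {suc n} t t' eq rewrite eq zero | first-ext (t ∘ suc) (t' ∘ suc) (eq ∘ suc) = refl

  first-sound : ∀ {n} (t : Fin n → Bool) {i} → first t ≡ just i → T (t i)
  first-sound {suc n} t {i} found with t zero in t₀
  first-sound {suc n} t {zero} refl | true = subst T (sym t₀) tt
  first-sound {suc n} t {i} found | false with first (t ∘ suc) in rest
  first-sound {suc n} t {suc i} refl | false | just _ = first-sound (t ∘ suc) rest

  first-complete : ∀ {n} (t : Fin n → Bool) i → T (t i) → ∃ λ j → first t ≡ just j
  first-complete {suc n} t zero    ti with t zero
  ... | true = zero , refl
  first-complete {suc n} t (suc i) ti with t zero
  ... | true  = zero , refl
  ... | false with first-complete (t ∘ suc) i ti
  ... | j , found rewrite found = suc j , refl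

  -- (2) Every compatible labeling has a potential.

  module PotentialConstruction {G : Graph} {d : ℕ} (f : ELabeling G d)
                               (even-cycles : EvenCycleProperty G d f) (halvable : Halvable G d f) where
    open GraphReachability G

    even-balanced : ∀ {r} (O : Walk G r r) → parity (length O) ≡ 0ℙ → altSum f O ≈ + 0 [mod d ]
    even-balanced {r} O even = ≡[mod]⇒≈ (even-cycles r O (parity⇒even (length O) even))

    odd-loops-agree : ∀ {r} (O O' : Walk G r r) → parity (length O) ≡ 1ℙ → parity (length O') ≡ 1ℙ →
                      altSum f O ≈ altSum f O' [mod d ]
    odd-loops-agree O O' odd odd' = ≈-by (+ 1) (sym value) (even-balanced (O ++ reverse O') loop-even)
      where
      open ≡-Reasoning
      loop-even : parity (length (O ++ reverse O')) ≡ 0ℙ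
      loop-even = begin
        parity (length (O ++ reverse O'))                  ≡⟨ parity-++ O (reverse O') ⟩
        parity (length O) ⊕ parity (length (reverse O'))   ≡⟨ cong₂ _⊕_ odd (trans (cong parity (length-reverse O')) odd') ⟩
        1ℙ ⊕ 1ℙ                                            ≡⟨⟩
        0ℙ                                                 ∎
      value : + 1 * (altSum f (O ++ reverse O') - + 0) ≡ altSum f O - altSum f O'
      value = begin
        + 1 * (altSum f (O ++ reverse O') - + 0)
          ≡⟨ cong (λ a → + 1 * (a - + 0)) (altSum-++ f O (reverse O')) ⟩
        + 1 * ((altSum f O + sign (parity (length O)) * altSum f (reverse O')) - + 0)
          ≡⟨ cong (λ a → + 1 * ((altSum f O + sign (parity (length O)) * a) - + 0)) (altSum-reverse f O') ⟩
        + 1 * ((altSum f O + sign (parity (length O)) * - (sign (parity (length O')) * altSum f O')) - + 0)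
          ≡⟨ cong₂ (λ p p' → + 1 * ((altSum f O + sign p * - (sign p' * altSum f O')) - + 0)) odd odd' ⟩
        + 1 * ((altSum f O + - + 1 * - (- + 1 * altSum f O')) - + 0)
          ≡⟨ simplify (altSum f O) (altSum f O') ⟩
        altSum f O - altSum f O' ∎
        where simplify : ∀ a a' → + 1 * ((a + - + 1 * - (- + 1 * a')) - + 0) ≡ a - a'
              simplify = solve-∀

    Centre : Fin (nV G) → ℤ → Set
    Centre r c = ∀ (O : Walk G r r) → Balanced d c (parity (length O)) (altSum f O)

    -- every vertex has a centre: a half of any odd closed walk, if one exists
    centre : ∀ r → ∃ (Centre r)
    centre r with odd-loop? r
    ... | no no-odd-loop = + 0 , centred
      where
      centred : Centre r (+ 0)
      centred O with parity (length O) in eq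
      ... | 0ℙ = even-balanced O eq
      ... | 1ℙ = ⊥-elim (no-odd-loop (O , eq))
    ... | yes (O₀ , odd₀) with halvable O₀ odd₀
    ... | c , c+c≈ = c , centred
      where
      centred : Centre r c
      centred O with parity (length O) in eq
      ... | 0ℙ = even-balanced O eq
      ... | 1ℙ = ≈-trans c+c≈ (odd-loops-agree O₀ O odd₀ eq)

    edge-relation : ∀ {r c a b e} → Centre r c → (P : Walk G r a) (P' : Walk G r b) → Joins G e a b →
                    lab (f e) ≈ sign (parity (length P)) * (c - altSum f P)
                                + sign (parity (length P')) * (c - altSum f P') [mod d ]
    edge-relation {c = c} {e = e} centred P P' j =
      balanced-edge p p' l c (altSum f P) (altSum f P') (subst₂ (Balanced d c) loop-parity loop-value (centred loop))
      where
      open ≡-Reasoning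
      l = lab (f e)
      p = parity (length P)
      p' = parity (length P')
      loop = P ++ step e j (reverse P')
      loop-parity : parity (length loop) ≡ p ⊕ p' ⁻¹
      loop-parity = begin
        parity (length loop)                               ≡⟨ parity-++ P (step e j (reverse P')) ⟩
        p ⊕ parity (suc (length (reverse P')))             ≡⟨ cong (λ n → p ⊕ parity (suc n)) (length-reverse P') ⟩
        p ⊕ parity (suc (length P'))                       ≡⟨ cong (p ⊕_) (parity-suc (length P')) ⟩
        p ⊕ p' ⁻¹                                          ∎
      loop-value : altSum f loop ≡ altSum f P + sign p * (l + sign p' * altSum f P')
      loop-value = begin
        altSum f loop                                      ≡⟨ altSum-++ f P (step e j (reverse P')) ⟩
        altSum f P + sign p * (l - altSum f (reverse P'))  ≡⟨ cong (λ a → altSum f P + sign p * (l - a)) (altSum-reverse f P') ⟩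
        altSum f P + sign p * (l - - (sign p' * altSum f P'))
                             ≡⟨ cong (λ a → altSum f P + sign p * (l + a)) (ℤP.neg-involutive (sign p' * altSum f P')) ⟩
        altSum f P + sign p * (l + sign p' * altSum f P')  ∎

    reached-from : Fin (nV G) → Fin (nV G) → Bool
    reached-from v r = isYes (walk? r v)

    -- v reaches itself, so a least vertex reaching v exists
    root-found : ∀ v → ∃ λ r → first (reached-from v) ≡ just r
    root-found v = first-complete (reached-from v) v (fromWitness [])

    root : Fin (nV G) → Fin (nV G)
    root v = proj₁ (root-found v)

    path : ∀ v → Walk G (root v) v
    path v = toWitness (first-sound (reached-from v) (proj₂ (root-found v)))

    -- vertices joined by a walk reach, and are reached from, the same vertices
    root-walk : ∀ {a b} → Walk G a b → root a ≡ root b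
    root-walk {a} {b} w = just-injective (begin
      just (root a)              ≡⟨ proj₂ (root-found a) ⟨
      first (reached-from a)     ≡⟨ first-ext _ _ same-reach ⟩
      first (reached-from b)     ≡⟨ proj₂ (root-found b) ⟩
      just (root b)              ∎)
      where
      open ≡-Reasoning
      same-reach : ∀ r → reached-from a r ≡ reached-from b r
      same-reach r = begin
        isYes (walk? r a)   ≡⟨ isYes≗does (walk? r a) ⟩
        does (walk? r a)    ≡⟨ does-⇔ (mk⇔ (_++ w) (_++ reverse w)) (walk? r a) (walk? r b) ⟩
        does (walk? r b)    ≡⟨ isYes≗does (walk? r b) ⟨
        isYes (walk? r b)   ∎

    potential : Fin (nV G) → ℤ
    potential v = sign (parity (length (path v))) * (proj₁ (centre (root v)) - altSum f (path v))

    potential-edge : ∀ {r r' a b} e → Joins G e a b → r ≡ r' → (P : Walk G r a) (P' : Walk G r' b) →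
                     lab (f e) ≈ sign (parity (length P)) * (proj₁ (centre r) - altSum f P)
                                 + sign (parity (length P')) * (proj₁ (centre r') - altSum f P') [mod d ]
    potential-edge e j refl P P' = edge-relation (proj₂ (centre _)) P P' j

    -- the edge e itself is a walk between its ends, so they share a root
    is-potential : IsPotential G d f potential
    is-potential = edge-sums λ e → potential-edge e (inj₁ refl) (root-walk (step e (inj₁ refl) [])) (path _) (path _)

  compatible⇒potential : ∀ {G d} .{{_ : NonZero d}} (f : ELabeling G d) → Compatible G d f →
                         ∃ (IsPotential G d f)
  compatible⇒potential f compat = potential , is-potential
    where open PotentialConstruction f (compatible⇒even compat) (compatible⇒halvable f compat)

  -- (3) Adding an edge.

  residue : ∀ {d} .{{_ : NonZero d}} (z : ℤ) → ∃ λ (x : Fin d) → lab x ≈ z [mod d ]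
  residue {d} z = fromℕ< (n%ℕd<d z d) , congruent (ℤD.divides (- (z /ℕ d)) (begin
    lab (fromℕ< (n%ℕd<d z d)) - z                    ≡⟨ cong₂ _-_ (cong +_ (FinP.toℕ-fromℕ< (n%ℕd<d z d))) (a≡a%ℕn+[a/ℕn]*n z d) ⟩
    + (z %ℕ d) - (+ (z %ℕ d) + (z /ℕ d) * + d)           ≡⟨ cancel (+ (z %ℕ d)) (z /ℕ d) (+ d) ⟩
    - (z /ℕ d) * + d                                      ∎))
    where
    open ≡-Reasoning
    cancel : ∀ r q d → r - (r + q * d) ≡ - q * d
    cancel = solve-∀

  pad : ∀ {n} a → (Fin n → ℤ) → Fin (n ℕ.+ a) → ℤ
  pad {n} a φ = [ φ , const (+ 0) ]′ ∘ splitAt n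

  pad-↑ˡ : ∀ {n} a (φ : Fin n → ℤ) v → pad a φ (v ↑ˡ a) ≡ φ v
  pad-↑ˡ {n} a φ v = cong [ φ , const (+ 0) ]′ (FinP.splitAt-↑ˡ n v a)

  -- the padded potential is a potential of the graph with the new edge, labelled by the
  -- residue of the potentials of its ends
  addEdge-potential : ∀ {G d} .{{_ : NonZero d}} {f : ELabeling G d} {φ} → IsPotential G d f φ →
                      ∀ a u w → ∃ λ x → IsPotential (addEdge G a u w) d (extend {G} {d} {a} {u} {w} f x) (pad a φ)
  addEdge-potential {G} {d} {f} {φ} potential a u w = x , edge-sums extended
    where
    x = proj₁ (residue (pad a φ u + pad a φ w))
    extended : ∀ e → lab (extend {G} {d} {a} {u} {w} f x e)
                     ≈ pad a φ (proj₁ (ends (addEdge G a u w) e)) + pad a φ (proj₂ (ends (addEdge G a u w) e)) [mod d ]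
    extended zero    = proj₂ (residue (pad a φ u + pad a φ w))
    extended (suc e) = subst (λ s → lab (f e) ≈ s [mod d ])
      (sym (cong₂ _+_ (pad-↑ˡ a φ (proj₁ (ends G e))) (pad-↑ˡ a φ (proj₂ (ends G e)))))
      (IsPotential.edge-sum potential e)

open import Defs
open import Data.Nat using (ℕ; zero; suc; _≤_; _+_)
open import Data.Fin using (Fin; _↑ʳ_)
open import Data.Product using (Σ; _,_)
open import Data.Sum using (_⊎_)
open import Relation.Binary.PropositionalEquality using (_≡_)
open CompatibleLabelings using (compatible⇒potential; addEdge-potential; module FromPotential)

-- Compatible labelings are those with a potential, and potentials extend along a new edge.
lemma7 : (d : ℕ) → 1 ≤ d → (G : Graph) (f : ELabeling G d) → Compatible G d f →
         (a : ℕ) (u w : Fin (nV G + a)) →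
         ((x : Fin a) → (nV G ↑ʳ x) ≡ u ⊎ (nV G ↑ʳ x) ≡ w) →
         Σ (Fin d) (λ x → Compatible (addEdge G a u w) d (extend {G} {d} {a} {u} {w} f x))
lemma7 zero    ()
lemma7 (suc _) _ G f compat a u w _ with compatible⇒potential f compat
... | φ , φ-potential with addEdge-potential φ-potential a u w
... | x , extended-potential = x , FromPotential.compatible extended-potential
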